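{- If $D$ is an orientation of a graph $G$, then \[K(D)=\sum_{\{u,v\}\subseteq V(D)}\theta_D(u,v)\le P(D)\le P(G).\]
   Context: Graphs are finite and simple. An orientation of $G$ is obtained by directing each edge. For a digraph $D$ and distinct vertices $u,v$, $\kappa_D(u,v)$ is the maximum number of internally disjoint directed $u$--$v$ paths, $\theta_D(u,v)=\kappa_D(u,v)+\kappa_D(v,u)$, and $K(D)$ is the sum of $\kappa_D(u,v)$ over all ordered pairs of distinct vertices. The potential of $D$ is $P(D)=\sum_{\{u,v\}}\left(\min\{\mathrm{od}(u),\mathrm{id}(v)\}+\min\{\mathrm{od}(v),\mathrm{id}(u)\}\right)$ over unordered pairs of distinct vertices, where od and id denote out- and in-degree. If $G$ has degree sequence $d_1,\dots,d_n$, its potential is $P(G)=\sum_{1\le i<j\le n}\min\{d_i,d_j\}$. -}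

module Defs where

open import Data.Nat using (ℕ; zero; suc; _+_; _≤_; _⊓_)
open import Data.Bool using (Bool; true; false; _∨_; _∧_; if_then_else_)
open import Data.Fin using (Fin; _<?_; _≟_)
open import Data.List using (List; []; _∷_; _++_; map; length; allFin)
open import Data.Nat.ListAction using (sum)
open import Data.List.Relation.Unary.Unique.Propositional using (Unique)
open import Data.List.Relation.Unary.AllPairs using (AllPairs)
open import Data.List.Relation.Unary.All using (All)
open import Data.List.Relation.Binary.Disjoint.Propositional using (Disjoint)
open import Data.Product using (Σ; _×_)
open import Data.Unit using (⊤)
open import Relation.Binary.PropositionalEquality using (_≡_; _≢_)
open import Relation.Nullary.Decidable using (⌊_⌋)

record Graph (n : ℕ) : Set where
  field
    adj    : Fin n → Fin n → Bool
    sym    : ∀ u v → adj u v ≡ adj v u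
    irrefl : ∀ u → adj u u ≡ false
open Graph public

Digraph : ℕ → Set
Digraph n = Fin n → Fin n → Bool

IsOrientation : ∀ {n} → Graph n → Digraph n → Set
IsOrientation {n} G D =
  (∀ (u v : Fin n) → adj G u v ≡ (D u v ∨ D v u)) ×
  (∀ (u v : Fin n) → (D u v ∧ D v u) ≡ false)

Σv : ∀ {n} → (Fin n → ℕ) → ℕ
Σv {n} f = sum (map f (allFin n))

[_] : Bool → ℕ
[ b ] = if b then 1 else 0

ΣPairs : ∀ {n} → (Fin n → Fin n → ℕ) → ℕ
ΣPairs f = Σv (λ u → Σv (λ v → if ⌊ u <? v ⌋ then f u v else 0))

ΣOrdered : ∀ {n} → (Fin n → Fin n → ℕ) → ℕ
ΣOrdered f = Σv (λ u → Σv (λ v → if ⌊ u ≟ v ⌋ then 0 else f u v))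

outdeg indeg : ∀ {n} → Digraph n → Fin n → ℕ
outdeg D u = Σv (λ v → [ D u v ])
indeg  D v = Σv (λ u → [ D u v ])

deg : ∀ {n} → Graph n → Fin n → ℕ
deg G u = Σv (λ v → [ adj G u v ])

PotD : ∀ {n} → Digraph n → ℕ
PotD D = ΣPairs (λ u v → (outdeg D u ⊓ indeg D v) + (outdeg D v ⊓ indeg D u))

PotG : ∀ {n} → Graph n → ℕ
PotG G = ΣPairs (λ u v → deg G u ⊓ deg G v)

IsWalk : ∀ {n} → Digraph n → List (Fin n) → Set
IsWalk D []           = ⊤
IsWalk D (x ∷ [])     = ⊤
IsWalk D (x ∷ y ∷ r)  = (D x y ≡ true) × IsWalk D (y ∷ r)

-- A directed u–v path, represented by its list of internal vertices w:
-- the vertex sequence u , w , v is a walk with no repeated vertex.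
IsPath : ∀ {n} → Digraph n → Fin n → Fin n → List (Fin n) → Set
IsPath D u v w = IsWalk D (u ∷ w ++ v ∷ []) × Unique (u ∷ w ++ v ∷ [])

IsDisjointPathFamily : ∀ {n} → Digraph n → Fin n → Fin n → List (List (Fin n)) → Set
IsDisjointPathFamily D u v ps =
  All (IsPath D u v) ps × AllPairs (λ p q → (p ≢ q) × Disjoint p q) ps

IsKappa : ∀ {n} → Digraph n → Fin n → Fin n → ℕ → Set
IsKappa D u v k =
  Σ (List (List (Fin _))) (λ ps → IsDisjointPathFamily D u v ps × length ps ≡ k) ×
  (∀ ps → IsDisjointPathFamily D u v ps → length ps ≤ k)

-- Internally disjoint directed u–v paths leave u along arcs with distinct heads and
-- enter v along arcs with distinct tails, so κ(u,v) ≤ min(od u, id v); summed over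
-- ordered pairs this is K(D) ≤ P(D). In an orientation deg = od + id, hence
-- min(od u, id v) + min(od v, id u) ≤ min(deg u, deg v) pair by pair, i.e. P(D) ≤ P(G).
-- The identity K(D) = Σ θ just splits ordered pairs into those with u < v and v < u.
module Submission where

open import Data.Bool using (Bool; true; false; _∧_; not; if_then_else_)
open import Data.Empty using (⊥-elim)
open import Data.Fin using (Fin; _<?_; _≟_)
open import Data.Fin.Properties using (<-cmp; <-asym; <-irrefl)
open import Data.List using (List; []; _∷_; _++_; map; length)
open import Data.List.Membership.Propositional using (_∈_)
open import Data.List.Properties using (map-tabulate; length-map)
open import Data.List.Relation.Binary.Disjoint.Propositional using (Disjoint)
open import Data.List.Relation.Unary.All using (All; []; _∷_)
import Data.List.Relation.Unary.All as All
open import Data.List.Relation.Unary.All.Properties using (++⁻ˡ; ++⁻ʳ; map⁺)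
open import Data.List.Relation.Unary.AllPairs using (AllPairs; []; _∷_)
open import Data.List.Relation.Unary.Any using (here; there)
open import Data.List.Relation.Unary.Unique.Propositional using (Unique)
open import Data.Nat using (ℕ; zero; suc; _+_; _≤_; _⊓_; z≤n; s≤s)
open import Data.Nat.ListAction using (sum)
open import Data.Nat.Properties
  using (+-0-commutativeMonoid; +-mono-≤; +-identityʳ; +-comm; ⊓-glb; m⊓n≤m; m⊓n≤n; module ≤-Reasoning)
open import Algebra.Properties.CommutativeMonoid.Sum +-0-commutativeMonoid
  using (∑-distrib-+; ∑-comm; sum-cong-≗; sum-replicate-zero)
  renaming (sum to ∑)
open import Data.Product using (_×_; _,_)
open import Function using (_∘_; id)
open import Relation.Binary using (tri<; tri≈; tri>)
open import Relation.Binary.PropositionalEquality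
  using (_≡_; _≢_; refl; sym; trans; cong; cong₂; subst; subst₂; module ≡-Reasoning)
open import Relation.Nullary using (yes; no)
open import Relation.Nullary.Decidable using (⌊_⌋)

open import Defs hiding (sym)

Σv-suc : ∀ {n} (f : Fin (suc n) → ℕ) → Σv f ≡ f Fin.zero + Σv (f ∘ Fin.suc)
Σv-suc f = cong (λ xs → f Fin.zero + sum xs)
  (trans (map-tabulate Fin.suc f) (sym (map-tabulate id (f ∘ Fin.suc))))

Σv≡∑ : ∀ {n} (f : Fin n → ℕ) → Σv f ≡ ∑ f
Σv≡∑ {zero}  f = refl
Σv≡∑ {suc n} f = trans (Σv-suc f) (cong (f Fin.zero +_) (Σv≡∑ (f ∘ Fin.suc)))

Σv-cong : ∀ {n} {f g : Fin n → ℕ} → (∀ x → f x ≡ g x) → Σv f ≡ Σv g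
Σv-cong {f = f} {g} f≗g = begin
  Σv f  ≡⟨ Σv≡∑ f ⟩
  ∑ f   ≡⟨ sum-cong-≗ f≗g ⟩
  ∑ g   ≡⟨ Σv≡∑ g ⟨
  Σv g  ∎
  where open ≡-Reasoning

Σv-distrib-+ : ∀ {n} (f g : Fin n → ℕ) → Σv (λ x → f x + g x) ≡ Σv f + Σv g
Σv-distrib-+ f g = begin
  Σv (λ x → f x + g x)  ≡⟨ Σv≡∑ (λ x → f x + g x) ⟩
  ∑ (λ x → f x + g x)   ≡⟨ ∑-distrib-+ f g ⟩
  ∑ f + ∑ g             ≡⟨ cong₂ _+_ (Σv≡∑ f) (Σv≡∑ g) ⟨
  Σv f + Σv g           ∎
  where open ≡-Reasoning

Σv-comm : ∀ {m n} (f : Fin m → Fin n → ℕ) →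
          Σv (λ x → Σv (λ y → f x y)) ≡ Σv (λ y → Σv (λ x → f x y))
Σv-comm f = begin
  Σv (λ x → Σv (λ y → f x y))  ≡⟨ Σv-cong (λ x → Σv≡∑ (f x)) ⟩
  Σv (λ x → ∑ (λ y → f x y))   ≡⟨ Σv≡∑ (λ x → ∑ (f x)) ⟩
  ∑ (λ x → ∑ (λ y → f x y))    ≡⟨ ∑-comm f ⟩
  ∑ (λ y → ∑ (λ x → f x y))    ≡⟨ Σv≡∑ (λ y → ∑ (λ x → f x y)) ⟨
  Σv (λ y → ∑ (λ x → f x y))   ≡⟨ Σv-cong (λ y → Σv≡∑ (λ x → f x y)) ⟨
  Σv (λ y → Σv (λ x → f x y))  ∎
  where open ≡-Reasoning

Σv-zero : ∀ n → Σv {n} (λ _ → 0) ≡ 0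
Σv-zero n = trans (Σv≡∑ {n} _) (sum-replicate-zero n)

Σv-mono-≤ : ∀ {n} {f g : Fin n → ℕ} → (∀ x → f x ≤ g x) → Σv f ≤ Σv g
Σv-mono-≤ {zero}  f≤g = z≤n
Σv-mono-≤ {suc n} {f} {g} f≤g
  rewrite Σv-suc f | Σv-suc g = +-mono-≤ (f≤g Fin.zero) (Σv-mono-≤ (f≤g ∘ Fin.suc))

if-distrib-+ : ∀ (b : Bool) m n → (if b then m + n else 0) ≡ (if b then m else 0) + (if b then n else 0)
if-distrib-+ true  m n = refl
if-distrib-+ false m n = refl

if-≢-split : ∀ {n} (u v : Fin n) m →
  (if ⌊ u ≟ v ⌋ then 0 else m) ≡ (if ⌊ u <? v ⌋ then m else 0) + (if ⌊ v <? u ⌋ then m else 0)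
if-≢-split u v m with u ≟ v | u <? v | v <? u
... | yes refl | yes u<u | _       = ⊥-elim (<-irrefl refl u<u)
... | yes refl | no _    | yes u<u = ⊥-elim (<-irrefl refl u<u)
... | yes _    | no _    | no _    = refl
... | no _     | yes u<v | yes v<u = ⊥-elim (<-asym u<v v<u)
... | no _     | yes _   | no _    = sym (+-identityʳ m)
... | no _     | no _    | yes _   = refl
... | no u≢v   | no u≮v  | no v≮u  with <-cmp u v
...   | tri< u<v _   _   = ⊥-elim (u≮v u<v)
...   | tri≈ _   u≡v _   = ⊥-elim (u≢v u≡v)
...   | tri> _   _   v<u = ⊥-elim (v≮u v<u)

ΣPairs-distrib-+ : ∀ {n} (f g : Fin n → Fin n → ℕ) →
  ΣPairs (λ u v → f u v + g u v) ≡ ΣPairs f + ΣPairs g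
ΣPairs-distrib-+ {n} f g = trans
  (Σv-cong λ u → trans (Σv-cong λ v → if-distrib-+ ⌊ u <? v ⌋ (f u v) (g u v)) (Σv-distrib-+ {n} _ _))
  (Σv-distrib-+ {n} _ _)

ΣOrdered≡ΣPairs : ∀ {n} (f : Fin n → Fin n → ℕ) → ΣOrdered f ≡ ΣPairs (λ u v → f u v + f v u)
ΣOrdered≡ΣPairs {n} f = begin
  ΣOrdered f
    ≡⟨ Σv-cong (λ u → trans (Σv-cong (λ v → if-≢-split u v (f u v))) (Σv-distrib-+ {n} _ _)) ⟩
  Σv (λ u → Σv (λ v → if ⌊ u <? v ⌋ then f u v else 0) + Σv (λ v → if ⌊ v <? u ⌋ then f u v else 0))
    ≡⟨ Σv-distrib-+ {n} _ _ ⟩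
  ΣPairs f + Σv (λ u → Σv (λ v → if ⌊ v <? u ⌋ then f u v else 0))
    ≡⟨ cong (ΣPairs f +_) (Σv-comm (λ u v → if ⌊ v <? u ⌋ then f u v else 0)) ⟩
  ΣPairs f + ΣPairs (λ u v → f v u)
    ≡⟨ ΣPairs-distrib-+ f (λ u v → f v u) ⟨
  ΣPairs (λ u v → f u v + f v u)
    ∎
  where open ≡-Reasoning

ΣPairs-mono-≤ : ∀ {n} {f g : Fin n → Fin n → ℕ} → (∀ u v → f u v ≤ g u v) → ΣPairs f ≤ ΣPairs g
ΣPairs-mono-≤ {f = f} {g} f≤g = Σv-mono-≤ λ u → Σv-mono-≤ λ v → restrict u v
  where
  restrict : ∀ u v → (if ⌊ u <? v ⌋ then f u v else 0) ≤ (if ⌊ u <? v ⌋ then g u v else 0)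
  restrict u v with ⌊ u <? v ⌋
  ... | true  = f≤g u v
  ... | false = z≤n

ΣOrdered-mono-≤ : ∀ {n} {f g : Fin n → Fin n → ℕ} → (∀ u v → u ≢ v → f u v ≤ g u v) →
  ΣOrdered f ≤ ΣOrdered g
ΣOrdered-mono-≤ {f = f} {g} f≤g = Σv-mono-≤ λ u → Σv-mono-≤ λ v → restrict u v
  where
  restrict : ∀ u v → (if ⌊ u ≟ v ⌋ then 0 else f u v) ≤ (if ⌊ u ≟ v ⌋ then 0 else g u v)
  restrict u v with u ≟ v
  ... | yes _   = z≤n
  ... | no  u≢v = f≤g u v u≢v

⌊suc≟suc⌋ : ∀ {n} (x y : Fin n) → ⌊ Fin.suc x ≟ Fin.suc y ⌋ ≡ ⌊ x ≟ y ⌋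
⌊suc≟suc⌋ x y with x ≟ y
... | yes _ = refl
... | no  _ = refl

Σv-[≟] : ∀ {n} (x : Fin n) → Σv (λ y → [ ⌊ y ≟ x ⌋ ]) ≡ 1
Σv-[≟] {suc n} Fin.zero    = trans (Σv-suc {n} (λ y → [ ⌊ y ≟ Fin.zero ⌋ ])) (cong suc (Σv-zero n))
Σv-[≟] {suc n} (Fin.suc x) = begin
  Σv (λ y → [ ⌊ y ≟ Fin.suc x ⌋ ])          ≡⟨ Σv-suc (λ y → [ ⌊ y ≟ Fin.suc x ⌋ ]) ⟩
  Σv (λ y → [ ⌊ Fin.suc y ≟ Fin.suc x ⌋ ])  ≡⟨ Σv-cong (λ y → cong [_] (⌊suc≟suc⌋ y x)) ⟩
  Σv (λ y → [ ⌊ y ≟ x ⌋ ])                  ≡⟨ Σv-[≟] x ⟩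
  1                                         ∎
  where open ≡-Reasoning

[]-split : ∀ b c → (c ≡ true → b ≡ true) → [ b ] ≡ [ b ∧ not c ] + [ c ]
[]-split true  true  _    = refl
[]-split true  false _    = refl
[]-split false false _    = refl
[]-split false true  c⇒b with () ← c⇒b refl

Σv-[]-remove : ∀ {n} (q : Fin n → Bool) {x} → q x ≡ true →
  Σv (λ y → [ q y ]) ≡ suc (Σv (λ y → [ q y ∧ not ⌊ y ≟ x ⌋ ]))
Σv-[]-remove {n} q {x} qx = begin
  Σv (λ y → [ q y ])
    ≡⟨ Σv-cong (λ y → []-split (q y) _ (y≡x⇒qy y)) ⟩
  Σv (λ y → [ q′ y ] + [ ⌊ y ≟ x ⌋ ])
    ≡⟨ Σv-distrib-+ {n} _ _ ⟩
  Σv (λ y → [ q′ y ]) + Σv (λ y → [ ⌊ y ≟ x ⌋ ])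
    ≡⟨ cong (Σv (λ y → [ q′ y ]) +_) (Σv-[≟] x) ⟩
  Σv (λ y → [ q′ y ]) + 1
    ≡⟨ +-comm _ 1 ⟩
  suc (Σv (λ y → [ q′ y ]))
    ∎
  where
  open ≡-Reasoning
  q′ : Fin n → Bool
  q′ y = q y ∧ not ⌊ y ≟ x ⌋
  y≡x⇒qy : ∀ y → ⌊ y ≟ x ⌋ ≡ true → q y ≡ true
  y≡x⇒qy y _ with y ≟ x
  ... | yes refl = qx

length≤Σv-[] : ∀ {n} (q : Fin n → Bool) {xs} → Unique xs → All (λ x → q x ≡ true) xs →
  length xs ≤ Σv (λ y → [ q y ])
length≤Σv-[] q [] [] = z≤n
length≤Σv-[] q {x ∷ xs} (x∉xs ∷ xs!) (qx ∷ qxs) rewrite Σv-[]-remove q qx =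
  s≤s (length≤Σv-[] (λ y → q y ∧ not ⌊ y ≟ x ⌋) xs! (All.zipWith still-holds (x∉xs , qxs)))
  where
  still-holds : ∀ {y} → x ≢ y × q y ≡ true → q y ∧ not ⌊ y ≟ x ⌋ ≡ true
  still-holds {y} (x≢y , qy) with y ≟ x
  ... | yes y≡x = ⊥-elim (x≢y (sym y≡x))
  ... | no  _   rewrite qy = refl

AllPairs-map-All : ∀ {a b r s p} {A : Set a} {B : Set b} {P : A → Set p}
  {R : A → A → Set r} {S : B → B → Set s} (f : A → B) →
  (∀ {x y} → P x → P y → R x y → S (f x) (f y)) →
  ∀ {xs} → All P xs → AllPairs R xs → AllPairs S (map f xs)
AllPairs-map-All f h []         []         = []
AllPairs-map-All f h (px ∷ pxs) (rx ∷ rxs) =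
  map⁺ (All.zipWith (λ (py , r) → h px py r) (pxs , rx)) ∷ AllPairs-map-All f h pxs rxs

module PathEnds {n} (D : Digraph n) (u v : Fin n) where

  afterSource : List (Fin n) → Fin n
  afterSource []      = v
  afterSource (x ∷ _) = x

  lastOf : Fin n → List (Fin n) → Fin n
  lastOf x []      = x
  lastOf _ (y ∷ w) = lastOf y w

  beforeTarget : List (Fin n) → Fin n
  beforeTarget = lastOf u

  lastOf-∈ : ∀ x w → lastOf x w ∈ x ∷ w
  lastOf-∈ x []      = here refl
  lastOf-∈ x (y ∷ w) = there (lastOf-∈ y w)

  walk-lastArc : ∀ x w → IsWalk D (x ∷ w ++ v ∷ []) → D (lastOf x w) v ≡ true
  walk-lastArc x []      (xv , _)  = xv
  walk-lastArc x (y ∷ w) (_ , walk) = walk-lastArc y w walk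

  afterSource-arc : ∀ {w} → IsPath D u v w → D u (afterSource w) ≡ true
  afterSource-arc {[]}    ((uv , _) , _) = uv
  afterSource-arc {_ ∷ _} ((ux , _) , _) = ux

  beforeTarget-arc : ∀ {w} → IsPath D u v w → D (beforeTarget w) v ≡ true
  beforeTarget-arc {w} (walk , _) = walk-lastArc u w walk

  source∉ : ∀ {w} → IsPath D u v w → All (u ≢_) w
  source∉ {w} (_ , u∉ ∷ _) = ++⁻ˡ w u∉

  target∉ : ∀ {x w} → IsPath D u v (x ∷ w) → x ≢ v
  target∉ {w = w} (_ , _ ∷ (x∉ ∷ _)) with ++⁻ʳ w x∉
  ... | x≢v ∷ _ = x≢v

  afterSource-injective : ∀ {p q} → IsPath D u v p → IsPath D u v q →
    (p ≢ q) × Disjoint p q → afterSource p ≢ afterSource q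
  afterSource-injective {[]}    {[]}    _  _  (p≢q , _)  = λ _ → p≢q refl
  afterSource-injective {[]}    {_ ∷ _} _  πq _          = target∉ πq ∘ sym
  afterSource-injective {_ ∷ _} {[]}    πp _  _          = target∉ πp
  afterSource-injective {_ ∷ _} {_ ∷ _} _  _  (_ , p∩q) = λ x≡y → p∩q (here refl , here x≡y)

  beforeTarget-injective : ∀ {p q} → IsPath D u v p → IsPath D u v q →
    (p ≢ q) × Disjoint p q → beforeTarget p ≢ beforeTarget q
  beforeTarget-injective {[]}    {[]}    _  _  (p≢q , _) = λ _ → p≢q refl
  beforeTarget-injective {[]}    {y ∷ s} _  πq _         = All.lookup (source∉ πq) (lastOf-∈ y s)
  beforeTarget-injective {x ∷ r} {[]}    πp _  _         = All.lookup (source∉ πp) (lastOf-∈ x r) ∘ sym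
  beforeTarget-injective {x ∷ r} {y ∷ s} _  _  (_ , p∩q) =
    λ e → p∩q (lastOf-∈ x r , subst (_∈ y ∷ s) (sym e) (lastOf-∈ y s))

  κ≤outdeg⊓indeg : ∀ {k} → IsKappa D u v k → k ≤ outdeg D u ⊓ indeg D v
  κ≤outdeg⊓indeg ((ps , (πs , distinct) , refl) , _) = ⊓-glb leaving entering
    where
    leaving : length ps ≤ outdeg D u
    leaving = subst (_≤ outdeg D u) (length-map afterSource ps) (length≤Σv-[] (D u)
      (AllPairs-map-All afterSource afterSource-injective πs distinct)
      (map⁺ (All.map afterSource-arc πs)))
    entering : length ps ≤ indeg D v
    entering = subst (_≤ indeg D v) (length-map beforeTarget ps) (length≤Σv-[] (λ x → D x v)
      (AllPairs-map-All beforeTarget beforeTarget-injective πs distinct)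
      (map⁺ (All.map beforeTarget-arc πs)))

m⊓p+o⊓n≤[m+n]⊓[o+p] : ∀ m n o p → m ⊓ p + o ⊓ n ≤ (m + n) ⊓ (o + p)
m⊓p+o⊓n≤[m+n]⊓[o+p] m n o p = ⊓-glb
  (+-mono-≤ (m⊓n≤m m p) (m⊓n≤n o n))
  (subst (_≤ o + p) (+-comm (o ⊓ n) (m ⊓ p)) (+-mono-≤ (m⊓n≤m o n) (m⊓n≤n m p)))

deg≡outdeg+indeg : ∀ {n} (G : Graph n) (D : Digraph n) → IsOrientation G D →
  ∀ u → deg G u ≡ outdeg D u + indeg D u
deg≡outdeg+indeg {n} G D (edge⇔arc , antisymmetric) u =
  trans (Σv-cong split) (Σv-distrib-+ {n} _ _)
  where
  split : ∀ v → [ adj G u v ] ≡ [ D u v ] + [ D v u ]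
  split v rewrite edge⇔arc u v with D u v | D v u | antisymmetric u v
  ... | true  | false | _ = refl
  ... | false | true  | _ = refl
  ... | false | false | _ = refl

PotD≤PotG : ∀ {n} (G : Graph n) (D : Digraph n) → IsOrientation G D → PotD D ≤ PotG G
PotD≤PotG G D orient = ΣPairs-mono-≤ λ u v →
  subst₂ (λ du dv → _ ≤ du ⊓ dv)
    (sym (deg≡outdeg+indeg G D orient u)) (sym (deg≡outdeg+indeg G D orient v))
    (m⊓p+o⊓n≤[m+n]⊓[o+p] (outdeg D u) (indeg D u) (outdeg D v) (indeg D v))

mainTheorem19 : (n : ℕ) (G : Graph n) (D : Digraph n) → IsOrientation G D →
    (κ : Fin n → Fin n → ℕ) → (∀ u v → u ≢ v → IsKappa D u v (κ u v)) →
    (ΣOrdered κ ≡ ΣPairs (λ u v → κ u v + κ v u)) ×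
    (ΣOrdered κ ≤ PotD D) × (PotD D ≤ PotG G)
mainTheorem19 n G D orient κ isκ = ΣOrdered≡ΣPairs κ , K≤PotD , PotD≤PotG G D orient
  where
  open ≤-Reasoning
  K≤PotD : ΣOrdered κ ≤ PotD D
  K≤PotD = begin
    ΣOrdered κ
      ≤⟨ ΣOrdered-mono-≤ (λ u v u≢v → PathEnds.κ≤outdeg⊓indeg D u v (isκ u v u≢v)) ⟩
    ΣOrdered (λ u v → outdeg D u ⊓ indeg D v)
      ≡⟨ ΣOrdered≡ΣPairs (λ u v → outdeg D u ⊓ indeg D v) ⟩
    PotD D
      ∎
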